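{- Let $\mathbf{L}=\langle L,\leq,\otimes,\rightarrow,0,1\rangle$ be a complete residuated lattice, let $K\subseteq L$ be a $\leq$-filter in $\mathbf{L}$, and let $Y\neq\emptyset$. An operator $C\colon L^Y\to L^Y$ is an $\mathbf{L}_K$-closure operator if and only if it is an $\mathbf{L}_{\{1\}}$-closure operator and $$C(a\rightarrow C(A))\subseteq a\rightarrow C(A)$$ holds for all $a\in K$ and all $A\in L^Y$.
   Context: A complete (commutative integral) residuated lattice: $\langle L,\leq\rangle$ complete lattice with bounds $0,1$, $\otimes$ associative, commutative with neutral $1$, and $a\otimes b\leq c$ iff $b\leq a\rightarrow c$. A $\leq$-filter is a nonempty $K\subseteq L$ such that $a\in K$ and $a\leq b$ imply $b\in K$. $L^Y$ is the set of maps $Y\to L$, with $A\subseteq B$ iff $A(y)\leq B(y)$ for all $y$; $(a\rightarrow A)(y)=a\rightarrow A(y)$; $S(A,B)=\bigwedge_{y\in Y}(A(y)\rightarrow B(y))$. An $\mathbf{L}_K$-closure operator is $C\colon L^Y\to L^Y$ with $A\subseteq C(A)$, $C(C(A))\subseteq C(A)$, and: if $S(A,B)\in K$ then $S(A,B)\leq S(C(A),C(B))$, for all $A,B\in L^Y$. An $\mathbf{L}_{\{1\}}$-closure operator is an ordinary closure operator on $\langle L^Y,\subseteq\rangle$ (extensive, monotone, idempotent). -}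

module Defs where

open import Level using (Level; _⊔_; suc)
open import Data.Product using (Σ; _×_)
open import Relation.Binary.PropositionalEquality using (_≡_)
open import Relation.Binary.Structures using (IsPartialOrder)

-- A complete (commutative integral) residuated lattice.
-- Carrier equality is propositional equality; completeness is with respect
-- to families indexed by types in Set ℓ (infima and suprema).
record CompleteResiduatedLattice (c ℓ : Level) : Set (suc (c ⊔ ℓ)) where
  infixr 7 _⊗_
  infixr 5 _⇒_
  infix 4 _≤_
  field
    Carrier   : Set c
    _≤_       : Carrier → Carrier → Set c
    isPartialOrder : IsPartialOrder _≡_ _≤_
    ⋀         : {I : Set ℓ} → (I → Carrier) → Carrier
    ⋀-lower   : {I : Set ℓ} (f : I → Carrier) (i : I) → ⋀ f ≤ f i
    ⋀-greatest : {I : Set ℓ} (f : I → Carrier) (x : Carrier) →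
                 ((i : I) → x ≤ f i) → x ≤ ⋀ f
    ⋁         : {I : Set ℓ} → (I → Carrier) → Carrier
    ⋁-upper   : {I : Set ℓ} (f : I → Carrier) (i : I) → f i ≤ ⋁ f
    ⋁-least   : {I : Set ℓ} (f : I → Carrier) (x : Carrier) →
                 ((i : I) → f i ≤ x) → ⋁ f ≤ x
    𝟘         : Carrier
    𝟙         : Carrier
    𝟘-least   : (x : Carrier) → 𝟘 ≤ x
    𝟙-greatest : (x : Carrier) → x ≤ 𝟙
    _⊗_       : Carrier → Carrier → Carrier
    ⊗-assoc   : (a b d : Carrier) → (a ⊗ b) ⊗ d ≡ a ⊗ (b ⊗ d)
    ⊗-comm    : (a b : Carrier) → a ⊗ b ≡ b ⊗ a
    ⊗-identityʳ : (a : Carrier) → a ⊗ 𝟙 ≡ a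
    _⇒_       : Carrier → Carrier → Carrier
    adj→      : (a b d : Carrier) → a ⊗ b ≤ d → b ≤ a ⇒ d
    adj←      : (a b d : Carrier) → b ≤ a ⇒ d → a ⊗ b ≤ d

module _ {c ℓ : Level} (𝐋 : CompleteResiduatedLattice c ℓ) where
  open CompleteResiduatedLattice 𝐋

  IsFilter : {k : Level} → (Carrier → Set k) → Set (c ⊔ k)
  IsFilter K = Σ Carrier K × ((a b : Carrier) → K a → a ≤ b → K b)

  module _ {Y : Set ℓ} where
    _⊆_ : (Y → Carrier) → (Y → Carrier) → Set (c ⊔ ℓ)
    A ⊆ B = (y : Y) → A y ≤ B y

    _⇒ₛ_ : Carrier → (Y → Carrier) → (Y → Carrier)
    (a ⇒ₛ A) y = a ⇒ A y

    S : (Y → Carrier) → (Y → Carrier) → Carrier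
    S A B = ⋀ (λ y → A y ⇒ B y)

    IsLKClosure : {k : Level} → (Carrier → Set k) →
                  ((Y → Carrier) → (Y → Carrier)) → Set (c ⊔ ℓ ⊔ k)
    IsLKClosure K C =
      ((A : Y → Carrier) → A ⊆ C A) ×
      ((A : Y → Carrier) → C (C A) ⊆ C A) ×
      ((A B : Y → Carrier) → K (S A B) → S A B ≤ S (C A) (C B))

    IsL1Closure : ((Y → Carrier) → (Y → Carrier)) → Set (c ⊔ ℓ)
    IsL1Closure C = IsLKClosure (λ a → a ≡ 𝟙) C

-- Both directions rest on the adjunction a ≤ S(A, B) iff A ⊆ a → B. If C is an
-- L_K-closure operator and a ∈ K, then a ≤ S(a → C A, C A), so a ≤ S(C(a → C A), C(C A)),
-- and idempotence turns this into C(a → C A) ⊆ a → C A. Conversely, for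
-- s = S(A, B) ∈ K we have A ⊆ s → C B, so monotonicity and the hypothesis give
-- C A ⊆ C(s → C B) ⊆ s → C B, that is s ≤ S(C A, C B).
module Submission where

open import Defs
open import Level using (Level; _⊔_)
open import Data.Product using (_×_; _,_)
open import Function.Bundles using (_⇔_; mk⇔; Equivalence)
open import Relation.Binary.PropositionalEquality using (_≡_; subst; sym)
open import Relation.Binary.Structures using (IsPartialOrder)
open import Relation.Binary.Bundles using (Poset)
import Relation.Binary.Reasoning.PartialOrder as PosetReasoning

module ResiduatedLatticeProperties {c ℓ : Level} (𝐋 : CompleteResiduatedLattice c ℓ) where
  open CompleteResiduatedLattice 𝐋
  open IsPartialOrder isPartialOrder using (antisym) renaming (refl to ≤-refl; trans to ≤-trans)

  poset : Poset c c c
  poset = record { isPartialOrder = isPartialOrder }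

  open PosetReasoning poset

  ⊗-⇒-≤ : ∀ a d → a ⊗ (a ⇒ d) ≤ d
  ⊗-⇒-≤ a d = adj← a (a ⇒ d) d ≤-refl

  ⇒-monoʳ-≤ : ∀ a {b d} → b ≤ d → a ⇒ b ≤ a ⇒ d
  ⇒-monoʳ-≤ a {b} {d} b≤d = adj→ a (a ⇒ b) d (≤-trans (⊗-⇒-≤ a b) b≤d)

  ⇒-exchange : ∀ {x a d} → x ≤ a ⇒ d → a ≤ x ⇒ d
  ⇒-exchange {x} {a} {d} x≤a⇒d =
    adj→ x a d (subst (_≤ d) (⊗-comm a x) (adj← a x d x≤a⇒d))

  ≤⇒𝟙≤⇒ : ∀ {a b} → a ≤ b → 𝟙 ≤ a ⇒ b
  ≤⇒𝟙≤⇒ {a} {b} a≤b = adj→ a 𝟙 b (subst (_≤ b) (sym (⊗-identityʳ a)) a≤b)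

  𝟙≤⇒⇒≤ : ∀ {a b} → 𝟙 ≤ a ⇒ b → a ≤ b
  𝟙≤⇒⇒≤ {a} {b} 𝟙≤a⇒b = subst (_≤ b) (⊗-identityʳ a) (adj← a 𝟙 b 𝟙≤a⇒b)

  module _ {Y : Set ℓ} where
    LSet : Set (c ⊔ ℓ)
    LSet = Y → Carrier

    S-lower : (A B : LSet) (y : Y) → S 𝐋 A B ≤ A y ⇒ B y
    S-lower A B = ⋀-lower (λ y → A y ⇒ B y)

    S-greatest : ∀ {x} (A B : LSet) → ((y : Y) → x ≤ A y ⇒ B y) → x ≤ S 𝐋 A B
    S-greatest {x} A B = ⋀-greatest (λ y → A y ⇒ B y) x

    ≤S⇔⊆⇒ₛ : ∀ {a} (A B : LSet) → a ≤ S 𝐋 A B ⇔ _⊆_ 𝐋 A (_⇒ₛ_ 𝐋 a B)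
    ≤S⇔⊆⇒ₛ A B = mk⇔ (λ a≤S y → ⇒-exchange (≤-trans a≤S (S-lower A B y)))
                     (λ A⊆a⇒B → S-greatest A B (λ y → ⇒-exchange (A⊆a⇒B y)))

    ⊆⇒S≡𝟙 : (A B : LSet) → _⊆_ 𝐋 A B → S 𝐋 A B ≡ 𝟙
    ⊆⇒S≡𝟙 A B A⊆B = antisym (𝟙-greatest _) (S-greatest A B (λ y → ≤⇒𝟙≤⇒ (A⊆B y)))

    𝟙≤S⇒⊆ : (A B : LSet) → 𝟙 ≤ S 𝐋 A B → _⊆_ 𝐋 A B
    𝟙≤S⇒⊆ A B 𝟙≤S y = 𝟙≤⇒⇒≤ (≤-trans 𝟙≤S (S-lower A B y))

    IsL1Closure⇒monotone : {C : LSet → LSet} → IsL1Closure 𝐋 C →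
                           (A B : LSet) → _⊆_ 𝐋 A B → _⊆_ 𝐋 (C A) (C B)
    IsL1Closure⇒monotone {C} (_ , _ , preserves) A B A⊆B =
      𝟙≤S⇒⊆ (C A) (C B) (subst (_≤ S 𝐋 (C A) (C B)) S≡𝟙 (preserves A B S≡𝟙))
      where
      S≡𝟙 : S 𝐋 A B ≡ 𝟙
      S≡𝟙 = ⊆⇒S≡𝟙 A B A⊆B

    module _ {k : Level} (K : Carrier → Set k) where
      IsLKClosure⇒IsL1Closure : K 𝟙 → {C : LSet → LSet} → IsLKClosure 𝐋 K C → IsL1Closure 𝐋 C
      IsLKClosure⇒IsL1Closure K𝟙 (extensive , idempotent , preserves) =
        extensive , idempotent , λ A B S≡𝟙 → preserves A B (subst K (sym S≡𝟙) K𝟙)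

      IsLKClosure⇒⇒ₛ-closed : ((a b : Carrier) → K a → a ≤ b → K b) →
        {C : LSet → LSet} → IsLKClosure 𝐋 K C →
        (a : Carrier) → K a → (A : LSet) → _⊆_ 𝐋 (C (_⇒ₛ_ 𝐋 a (C A))) (_⇒ₛ_ 𝐋 a (C A))
      IsLKClosure⇒⇒ₛ-closed upward {C} (_ , idempotent , preserves) a Ka A =
        Equivalence.to (≤S⇔⊆⇒ₛ (C B) (C A)) (begin
          a                     ≤⟨ a≤S ⟩
          S 𝐋 B (C A)           ≤⟨ preserves B (C A) (upward a _ Ka a≤S) ⟩
          S 𝐋 (C B) (C (C A))   ≤⟨ S-greatest (C B) (C A) (λ y → ≤-trans (S-lower (C B) (C (C A)) y)
                                                                    (⇒-monoʳ-≤ (C B y) (idempotent A y))) ⟩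
          S 𝐋 (C B) (C A)       ∎)
        where
        B : LSet
        B = _⇒ₛ_ 𝐋 a (C A)
        a≤S : a ≤ S 𝐋 B (C A)
        a≤S = Equivalence.from (≤S⇔⊆⇒ₛ B (C A)) (λ _ → ≤-refl)

      IsL1Closure⇒IsLKClosure : {C : LSet → LSet} → IsL1Closure 𝐋 C →
        ((a : Carrier) → K a → (A : LSet) → _⊆_ 𝐋 (C (_⇒ₛ_ 𝐋 a (C A))) (_⇒ₛ_ 𝐋 a (C A))) →
        IsLKClosure 𝐋 K C
      IsL1Closure⇒IsLKClosure {C} closure@(extensive , idempotent , _) ⇒ₛ-closed =
        extensive , idempotent , preserves
        where
        preserves : (A B : LSet) → K (S 𝐋 A B) → S 𝐋 A B ≤ S 𝐋 (C A) (C B)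
        preserves A B Ks = Equivalence.from (≤S⇔⊆⇒ₛ (C A) (C B)) (λ y →
          ≤-trans (IsL1Closure⇒monotone closure A (_⇒ₛ_ 𝐋 s (C B)) A⊆s⇒CB y)
                  (⇒ₛ-closed s Ks B y))
          where
          s : Carrier
          s = S 𝐋 A B
          A⊆s⇒CB : _⊆_ 𝐋 A (_⇒ₛ_ 𝐋 s (C B))
          A⊆s⇒CB y = ≤-trans (Equivalence.to (≤S⇔⊆⇒ₛ A B) ≤-refl y) (⇒-monoʳ-≤ s (extensive B y))

theorem9 : {c ℓ k : Level} (𝐋 : CompleteResiduatedLattice c ℓ)
    (K : CompleteResiduatedLattice.Carrier 𝐋 → Set k) → IsFilter 𝐋 K →
    (Y : Set ℓ) → Y →
    (C : (Y → CompleteResiduatedLattice.Carrier 𝐋) → (Y → CompleteResiduatedLattice.Carrier 𝐋)) →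
    IsLKClosure 𝐋 K C ⇔
    (IsL1Closure 𝐋 C ×
    ((a : CompleteResiduatedLattice.Carrier 𝐋) → K a → (A : Y → CompleteResiduatedLattice.Carrier 𝐋) →
    _⊆_ 𝐋 (C (_⇒ₛ_ 𝐋 a (C A))) (_⇒ₛ_ 𝐋 a (C A))))
theorem9 𝐋 K ((w , Kw) , upward) Y _ C =
  mk⇔ (λ closure → IsLKClosure⇒IsL1Closure K K𝟙 closure , IsLKClosure⇒⇒ₛ-closed K upward closure)
      (λ (closure , ⇒ₛ-closed) → IsL1Closure⇒IsLKClosure K closure ⇒ₛ-closed)
  where
  open CompleteResiduatedLattice 𝐋 using (𝟙; 𝟙-greatest)
  open ResiduatedLatticeProperties 𝐋
  K𝟙 : K 𝟙
  K𝟙 = upward w 𝟙 Kw (𝟙-greatest w)
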